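{- Let $G\le S_k$ be a permutation group on $k$ points generated by permutations $s$ and $t$, where $t$ is an involution, $s$ has order $n$ and $st$ has order $m$, and put $r:=ts^{ -1}$. Suppose every automorphism of $G$ is induced by conjugation by some element of $S_k$. Suppose moreover that: (i) for some nonzero integer $b$ there is exactly one point $\zeta$ which is fixed by $s^bt$ but not fixed by $t$; and (ii) there is an integer $c$ such that $\zeta s^c$ is fixed by $t$ while $\zeta t s^{ -c}$ is not fixed by $t$. Then the orientably-regular map $\mathcal{M}(G:r,s)$ is chiral.
   Context: Permutations act on the right ($\zeta g$ is the image of the point $\zeta$ under $g$) and products are composed left to right. For a finite group $G$ generated by $r,s$ with $rs$ an involution, $\mathcal{M}(G:r,s)$ denotes the orientably-regular map with orientation-preserving automorphism group $G$, in which $r$ and $s$ are one-step rotations about a face and an incident vertex; its type is $\{m,n\}$ where $m,n$ are the orders of $r,s$. It is reflexible if some group automorphism of $G$ maps $r\mapsto r^{ -1}$ and $s\mapsto s^{ -1}$, and chiral otherwise. -}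

module Defs where

open import Data.Nat using (ℕ; zero; suc; _<_)
open import Data.Integer using (ℤ; +_; -[1+_])
open import Data.Fin using (Fin)
open import Data.Fin.Permutation using (Permutation′; _⟨$⟩ʳ_; _≈_; id; flip; _∘ₚ_) public
open import Data.Product using (Σ; ∃; _×_; _,_; proj₁)
open import Relation.Binary.PropositionalEquality using (_≡_)
open import Relation.Nullary using (¬_)

-- Action on the right: ζ g is  g ⟨$⟩ʳ ζ.
-- Products left to right:  g · h = g ∘ₚ h  satisfies  (g · h) ⟨$⟩ʳ ζ = h ⟨$⟩ʳ (g ⟨$⟩ʳ ζ).
Perm : ℕ → Set
Perm k = Permutation′ k

infixl 7 _·_
_·_ : ∀ {k} → Perm k → Perm k → Perm k
g · h = g ∘ₚ h

_⁻¹ : ∀ {k} → Perm k → Perm k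
g ⁻¹ = flip g

_^ℕ_ : ∀ {k} → Perm k → ℕ → Perm k
g ^ℕ zero = id
g ^ℕ suc n = g · (g ^ℕ n)

_^_ : ∀ {k} → Perm k → ℤ → Perm k
g ^ (+ n) = g ^ℕ n
g ^ -[1+ n ] = (g ⁻¹) ^ℕ suc n

HasOrder : ∀ {k} → Perm k → ℕ → Set
HasOrder g n = (0 < n) × (g ^ℕ n ≈ id) × (∀ j → 0 < j → j < n → ¬ (g ^ℕ j ≈ id))

Fixes : ∀ {k} → Perm k → Fin k → Set
Fixes g ζ = g ⟨$⟩ʳ ζ ≡ ζ

data Word : Set where
  gen₁ gen₂ one : Word
  _⊗_ : Word → Word → Word
  inv : Word → Word

eval : ∀ {k} → Perm k → Perm k → Word → Perm k
eval a b gen₁ = a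
eval a b gen₂ = b
eval a b one = id
eval a b (u ⊗ v) = eval a b u · eval a b v
eval a b (inv u) = eval a b u ⁻¹

_∈⟨_,_⟩ : ∀ {k} → Perm k → Perm k → Perm k → Set
g ∈⟨ a , b ⟩ = ∃ λ w → eval a b w ≈ g

Elt : ∀ {k} → Perm k → Perm k → Set
Elt {k} a b = Σ (Perm k) (λ g → g ∈⟨ a , b ⟩)

record Aut {k} (a b : Perm k) : Set where
  field
    φ    : Elt a b → Elt a b
    cong : ∀ (x y : Elt a b) → proj₁ x ≈ proj₁ y → proj₁ (φ x) ≈ proj₁ (φ y)
    hom  : ∀ (x y xy : Elt a b) → proj₁ xy ≈ proj₁ x · proj₁ y →
           proj₁ (φ xy) ≈ proj₁ (φ x) · proj₁ (φ y)
    inj  : ∀ (x y : Elt a b) → proj₁ (φ x) ≈ proj₁ (φ y) → proj₁ x ≈ proj₁ y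
    surj : ∀ (y : Elt a b) → ∃ λ x → proj₁ (φ x) ≈ proj₁ y

InducedByConjugation : ∀ {k} {a b : Perm k} → Aut a b → Set
InducedByConjugation {k} {a} {b} α =
  ∃ λ (x : Perm k) → ∀ (y : Elt a b) → proj₁ (Aut.φ α y) ≈ (x ⁻¹) · proj₁ y · x

-- M(G : r , s) with G = ⟨r , s⟩ is reflexible iff some automorphism of G
-- maps r ↦ r⁻¹ and s ↦ s⁻¹; chiral otherwise.
Reflexible : ∀ {k} (r s : Perm k) → Set
Reflexible r s = ∃ λ (α : Aut r s) →
  (∀ (y : Elt r s) → proj₁ y ≈ r → proj₁ (Aut.φ α y) ≈ r ⁻¹) ×
  (∀ (y : Elt r s) → proj₁ y ≈ s → proj₁ (Aut.φ α y) ≈ s ⁻¹)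

Chiral : ∀ {k} (r s : Perm k) → Set
Chiral r s = ¬ Reflexible r s

{-# OPTIONS --safe #-}

-- If the map were reflexible, the automorphism r ↦ r⁻¹, s ↦ s⁻¹ sends t = r s to
-- s t s⁻¹, so by hypothesis it is conjugation by some x ∈ S_k, and y := x s inverts s
-- and centralises t. Such a y carries the points fixed by s^b t and moved by t to
-- points of the same kind (after applying t), so by uniqueness it maps ζ to ζ t. Then y
-- sends the t-fixed point ζ s^c to ζ t s^{-c}, which would have to be t-fixed as well.

module Submission where

open import Defs
open import Data.Nat using (ℕ; zero; suc)
open import Data.Integer using (ℤ; 0ℤ; -_; +_; -[1+_])
open import Data.Integer.Properties using (neg-involutive)
open import Data.Fin using (Fin)
open import Data.Fin.Permutation using (inverseˡ; inverseʳ)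
open import Data.Product using (∃; _×_; _,_; proj₁; proj₂)
open import Relation.Binary.PropositionalEquality
  using (_≡_; _≢_; refl; sym; trans; cong; subst; module ≡-Reasoning)
open import Relation.Nullary using (¬_)

private
  variable
    k : ℕ
    a b c d g g′ h h′ s t y z : Perm k
    ζ : Fin k

open ≡-Reasoning

·-cong : g ≈ g′ → h ≈ h′ → g · h ≈ g′ · h′
·-cong {h = h} p q i = trans (cong (h ⟨$⟩ʳ_) (p i)) (q _)

⁻¹-cong : g ≈ h → g ⁻¹ ≈ h ⁻¹
⁻¹-cong {g = g} {h = h} p i = begin
  g ⁻¹ ⟨$⟩ʳ i                       ≡⟨ cong (g ⁻¹ ⟨$⟩ʳ_) (sym (inverseʳ h)) ⟩
  g ⁻¹ ⟨$⟩ʳ (h ⟨$⟩ʳ (h ⁻¹ ⟨$⟩ʳ i))  ≡⟨ cong (g ⁻¹ ⟨$⟩ʳ_) (sym (p _)) ⟩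
  g ⁻¹ ⟨$⟩ʳ (g ⟨$⟩ʳ (h ⁻¹ ⟨$⟩ʳ i))  ≡⟨ inverseˡ g ⟩
  h ⁻¹ ⟨$⟩ʳ i                       ∎

involution⇒⁻¹≈ : t · t ≈ id → t ⁻¹ ≈ t
involution⇒⁻¹≈ {t = t} t² i = trans (sym (t² _)) (cong (t ⟨$⟩ʳ_) (inverseʳ t))

record Conjugates (y g h : Perm k) : Set where
  constructor conjugates
  field
    intertwines : g · y ≈ y · h

open Conjugates

≈-conjugate⇒Conjugates : h ≈ y ⁻¹ · g · y → Conjugates y g h
≈-conjugate⇒Conjugates {h = h} {y = y} {g = g} p = conjugates λ i → begin
  y ⟨$⟩ʳ (g ⟨$⟩ʳ i)                        ≡⟨ cong (λ j → y ⟨$⟩ʳ (g ⟨$⟩ʳ j)) (sym (inverseˡ y)) ⟩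
  (y ⁻¹ · g · y) ⟨$⟩ʳ (y ⟨$⟩ʳ i)            ≡⟨ sym (p _) ⟩
  h ⟨$⟩ʳ (y ⟨$⟩ʳ i)                        ∎

Conjugates-self : Conjugates g g g
Conjugates-self = conjugates λ _ → refl

Conjugates-trans : Conjugates z g h → Conjugates y h h′ → Conjugates (z · y) g h′
Conjugates-trans {y = y} p q =
  conjugates λ i → trans (cong (y ⟨$⟩ʳ_) (intertwines p i)) (intertwines q _)

Conjugates-· : Conjugates y g h → Conjugates y g′ h′ → Conjugates y (g · g′) (h · h′)
Conjugates-· {h′ = h′} p q =
  conjugates λ i → trans (intertwines q _) (cong (h′ ⟨$⟩ʳ_) (intertwines p i))

Conjugates-⁻¹ : Conjugates y g h → Conjugates y (g ⁻¹) (h ⁻¹)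
Conjugates-⁻¹ {y = y} {g = g} {h = h} p = conjugates λ i → begin
  y ⟨$⟩ʳ (g ⁻¹ ⟨$⟩ʳ i)                           ≡⟨ sym (inverseˡ h) ⟩
  h ⁻¹ ⟨$⟩ʳ (h ⟨$⟩ʳ (y ⟨$⟩ʳ (g ⁻¹ ⟨$⟩ʳ i)))      ≡⟨ cong (h ⁻¹ ⟨$⟩ʳ_) (sym (intertwines p _)) ⟩
  h ⁻¹ ⟨$⟩ʳ (y ⟨$⟩ʳ (g ⟨$⟩ʳ (g ⁻¹ ⟨$⟩ʳ i)))      ≡⟨ cong (λ j → h ⁻¹ ⟨$⟩ʳ (y ⟨$⟩ʳ j)) (inverseʳ g) ⟩
  h ⁻¹ ⟨$⟩ʳ (y ⟨$⟩ʳ i)                           ∎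

Conjugates-^ℕ : Conjugates y g h → ∀ n → Conjugates y (g ^ℕ n) (h ^ℕ n)
Conjugates-^ℕ p zero    = conjugates λ _ → refl
Conjugates-^ℕ p (suc n) = Conjugates-· p (Conjugates-^ℕ p n)

Conjugates-^ : Conjugates y g h → ∀ c → Conjugates y (g ^ c) (h ^ c)
Conjugates-^ p (+ n)    = Conjugates-^ℕ p n
Conjugates-^ p -[1+ n ] = Conjugates-^ℕ (Conjugates-⁻¹ p) (suc n)

-- Once c is split, s ^ (- c) is definitionally (s ⁻¹) ^ c, since (s ⁻¹) ⁻¹ reduces to s.
Conjugates-inverting-^ : Conjugates y s (s ⁻¹) → ∀ c → Conjugates y (s ^ c) (s ^ (- c))
Conjugates-inverting-^ p (+ zero)  = Conjugates-^ p (+ zero)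
Conjugates-inverting-^ p (+ suc n) = Conjugates-^ p (+ suc n)
Conjugates-inverting-^ p -[1+ n ]  = Conjugates-^ p -[1+ n ]

Conjugates-Fixes : Conjugates y g h → Fixes g ζ → Fixes h (y ⟨$⟩ʳ ζ)
Conjugates-Fixes {y = y} p fixed = trans (sym (intertwines p _)) (cong (y ⟨$⟩ʳ_) fixed)

Conjugates-reflects-Fixes : Conjugates y g h → Fixes h (y ⟨$⟩ʳ ζ) → Fixes g ζ
Conjugates-reflects-Fixes {y = y} {g = g} {ζ = ζ} p fixed = begin
  g ⟨$⟩ʳ ζ                          ≡⟨ sym (inverseˡ y) ⟩
  y ⁻¹ ⟨$⟩ʳ (y ⟨$⟩ʳ (g ⟨$⟩ʳ ζ))      ≡⟨ cong (y ⁻¹ ⟨$⟩ʳ_) (trans (intertwines p ζ) fixed) ⟩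
  y ⁻¹ ⟨$⟩ʳ (y ⟨$⟩ʳ ζ)              ≡⟨ inverseˡ y ⟩
  ζ                                 ∎

^ℕ-inverseˡ : ∀ n → (g ⁻¹) ^ℕ n ⟨$⟩ʳ (g ^ℕ n ⟨$⟩ʳ ζ) ≡ ζ
^ℕ-inverseˡ             zero    = refl
^ℕ-inverseˡ {g = g} {ζ} (suc n) = begin
  (g ⁻¹) ^ℕ n ⟨$⟩ʳ (g ⁻¹ ⟨$⟩ʳ (g ^ℕ n ⟨$⟩ʳ (g ⟨$⟩ʳ ζ)))
    ≡⟨ cong (λ j → (g ⁻¹) ^ℕ n ⟨$⟩ʳ (g ⁻¹ ⟨$⟩ʳ j))
            (sym (intertwines (Conjugates-^ℕ (Conjugates-self {g = g}) n) ζ)) ⟩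
  (g ⁻¹) ^ℕ n ⟨$⟩ʳ (g ⁻¹ ⟨$⟩ʳ (g ⟨$⟩ʳ (g ^ℕ n ⟨$⟩ʳ ζ)))
    ≡⟨ cong ((g ⁻¹) ^ℕ n ⟨$⟩ʳ_) (inverseˡ g) ⟩
  (g ⁻¹) ^ℕ n ⟨$⟩ʳ (g ^ℕ n ⟨$⟩ʳ ζ)
    ≡⟨ ^ℕ-inverseˡ n ⟩
  ζ ∎

^-neg-inverseˡ : ∀ c → s ^ (- c) ⟨$⟩ʳ (s ^ c ⟨$⟩ʳ ζ) ≡ ζ
^-neg-inverseˡ         (+ zero)  = refl
^-neg-inverseˡ         (+ suc n) = ^ℕ-inverseˡ (suc n)
^-neg-inverseˡ {s = s} -[1+ n ]  = ^ℕ-inverseˡ {g = s ⁻¹} (suc n)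

substitute : Word → Word → Word → Word
substitute u v gen₁     = u
substitute u v gen₂     = v
substitute u v one      = one
substitute u v (w ⊗ w′) = substitute u v w ⊗ substitute u v w′
substitute u v (inv w)  = inv (substitute u v w)

eval-substitute : ∀ {a′ b′ : Perm k} u v → a′ ≈ eval a b u → b′ ≈ eval a b v →
                  ∀ w → eval a′ b′ w ≈ eval a b (substitute u v w)
eval-substitute u v p q gen₁     = p
eval-substitute u v p q gen₂     = q
eval-substitute u v p q one      = λ _ → refl
eval-substitute {a = a} {b = b} {a′ = a′} {b′ = b′} u v p q (w ⊗ w′) =
  ·-cong {g = eval a′ b′ w} {eval a b (substitute u v w)}
         {eval a′ b′ w′} {eval a b (substitute u v w′)}
         (eval-substitute u v p q w) (eval-substitute u v p q w′)
eval-substitute {a = a} {b = b} {a′ = a′} {b′ = b′} u v p q (inv w) =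
  ⁻¹-cong {g = eval a′ b′ w} {eval a b (substitute u v w)} (eval-substitute u v p q w)

∈⟨⟩-trans : {a b c d g : Perm k} → a ∈⟨ c , d ⟩ → b ∈⟨ c , d ⟩ → g ∈⟨ a , b ⟩ → g ∈⟨ c , d ⟩
∈⟨⟩-trans (u , eval≈a) (v , eval≈b) (w , eval≈g) =
  substitute u v w , λ i →
    trans (sym (eval-substitute u v (λ j → sym (eval≈a j)) (λ j → sym (eval≈b j)) w i)) (eval≈g i)

Aut-transfer : c ∈⟨ a , b ⟩ → d ∈⟨ a , b ⟩ → a ∈⟨ c , d ⟩ → b ∈⟨ c , d ⟩ → Aut c d → Aut a b
Aut-transfer {c = c} {a = a} {b = b} {d = d} c∈ d∈ a∈ b∈ α = record
  { φ    = λ y → from (α.φ (to y))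
  ; cong = λ y y′ → α.cong (to y) (to y′)
  ; hom  = λ y y′ yy′ → α.hom (to y) (to y′) (to yy′)
  ; inj  = λ y y′ → α.inj (to y) (to y′)
  ; surj = λ y → let (x , φx≈y) = α.surj (to y) in
                 from x , λ i → trans (α.cong (to (from x)) x (λ _ → refl) i) (φx≈y i)
  }
  where
  module α = Aut α
  to : Elt a b → Elt c d
  to (g , g∈) = g , ∈⟨⟩-trans {a = a} {b} {c} {d} {g} a∈ b∈ g∈
  from : Elt c d → Elt a b
  from (g , g∈) = g , ∈⟨⟩-trans {a = c} {d} {a} {b} {g} c∈ d∈ g∈

reflexible⇒conjugator : t · t ≈ id → (∀ (α : Aut s t) → InducedByConjugation α) →
                        Reflexible (t · s ⁻¹) s →
                        ∃ λ y → Conjugates y s (s ⁻¹) × Conjugates y t t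
reflexible⇒conjugator {t = t} {s = s} t² induced (α , α-r , α-s) =
  x · s , Conjugates-trans x-inverts-s s-centralises-s⁻¹
        , Conjugates-trans x-conjugates-t s-conjugates-αt
  where
  r : Perm _
  r = t · s ⁻¹
  module α = Aut α
  β : Aut s t
  β = Aut-transfer (gen₂ ⊗ inv gen₁ , λ _ → refl) (gen₁ , λ _ → refl)
                   (gen₂ , λ _ → refl) (gen₁ ⊗ gen₂ , λ _ → inverseʳ s) α
  x : Perm _
  x = proj₁ (induced β)
  x-induces-β : ∀ g → proj₁ (Aut.φ β g) ≈ x ⁻¹ · proj₁ g · x
  x-induces-β = proj₂ (induced β)
  x-inverts-s : Conjugates x s (s ⁻¹)
  x-inverts-s = ≈-conjugate⇒Conjugates λ i →
    trans (sym (α-s _ (λ _ → refl) i)) (x-induces-β (s , gen₁ , λ _ → refl) i)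
  αt≈r⁻¹s⁻¹ : proj₁ (Aut.φ β (t , gen₂ , λ _ → refl)) ≈ r ⁻¹ · s ⁻¹
  αt≈r⁻¹s⁻¹ i =
    trans (α.hom (r , gen₁ , λ _ → refl) (s , gen₂ , λ _ → refl) _ (λ _ → sym (inverseʳ s)) i)
          (trans (cong (proj₁ (α.φ (s , gen₂ , λ _ → refl)) ⟨$⟩ʳ_) (α-r _ (λ _ → refl) i))
                 (α-s _ (λ _ → refl) _))
  x-conjugates-t : Conjugates x t (r ⁻¹ · s ⁻¹)
  x-conjugates-t = ≈-conjugate⇒Conjugates λ i →
    trans (sym (αt≈r⁻¹s⁻¹ i)) (x-induces-β (t , gen₂ , λ _ → refl) i)
  s-centralises-s⁻¹ : Conjugates s (s ⁻¹) (s ⁻¹)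
  s-centralises-s⁻¹ = conjugates λ _ → trans (inverseʳ s) (sym (inverseˡ s))
  s-conjugates-αt : Conjugates s (r ⁻¹ · s ⁻¹) t
  s-conjugates-αt = conjugates λ i →
    trans (inverseʳ s) (involution⇒⁻¹≈ {t = t} t² (s ⟨$⟩ʳ i))

Fixes-·-involution : t · t ≈ id → Fixes (g · t) ζ → g ⟨$⟩ʳ ζ ≡ t ⟨$⟩ʳ ζ
Fixes-·-involution {t = t} t² fixed = trans (sym (t² _)) (cong (t ⟨$⟩ʳ_) fixed)

conjugator-moves-unique-point-by-t :
  t · t ≈ id → Conjugates y s (s ⁻¹) → Conjugates y t t → ∀ b →
  Fixes (s ^ b · t) ζ → ¬ Fixes t ζ → (∀ ξ → Fixes (s ^ b · t) ξ → ¬ Fixes t ξ → ξ ≡ ζ) →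
  y ⟨$⟩ʳ ζ ≡ t ⟨$⟩ʳ ζ
conjugator-moves-unique-point-by-t {t = t} {y = y} {s = s} {ζ = ζ}
                                   t² y-inverts-s y-centralises-t b ζ-fixed ζ-moved unique =
  trans (sym (t² _)) (cong (t ⟨$⟩ʳ_) (unique ξ ξ-fixed ξ-moved))
  where
  ξ : Fin _
  ξ = t ⟨$⟩ʳ (y ⟨$⟩ʳ ζ)
  y-conjugates : Conjugates y (t · s ^ (- b)) (t · s ^ b)
  y-conjugates = Conjugates-· y-centralises-t
    (subst (λ e → Conjugates y (s ^ (- b)) (s ^ e)) (neg-involutive b)
           (Conjugates-inverting-^ y-inverts-s (- b)))
  ζ-fixed′ : Fixes (t · s ^ (- b)) ζ
  ζ-fixed′ = trans (cong (s ^ (- b) ⟨$⟩ʳ_) (sym (Fixes-·-involution {t = t} {g = s ^ b} t² ζ-fixed)))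
                   (^-neg-inverseˡ b)
  ξ-fixed : Fixes (s ^ b · t) ξ
  ξ-fixed = cong (t ⟨$⟩ʳ_) (Conjugates-Fixes y-conjugates ζ-fixed′)
  ξ-moved : ¬ Fixes t ξ
  ξ-moved ξ-fixed′ =
    ζ-moved (Conjugates-reflects-Fixes y-centralises-t (trans (sym ξ-fixed′) (t² _)))

lemma2p3 : (k : ℕ) (s t : Perm k) (n m : ℕ) →
    HasOrder t 2 → HasOrder s n → HasOrder (s · t) m →
    (∀ (α : Aut s t) → InducedByConjugation α) →
    (∃ λ (b : ℤ) → b ≢ 0ℤ × ∃ λ (ζ : Fin k) →
        (Fixes (s ^ b · t) ζ × ¬ Fixes t ζ)
      × (∀ (ξ : Fin k) → Fixes (s ^ b · t) ξ → ¬ Fixes t ξ → ξ ≡ ζ)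
      × (∃ λ (c : ℤ) → Fixes t ((s ^ c) ⟨$⟩ʳ ζ)
                     × ¬ Fixes t (s ^ (- c) ⟨$⟩ʳ (t ⟨$⟩ʳ ζ)))) →
    Chiral (t · s ⁻¹) s
lemma2p3 _ s t _ _ (_ , t² , _) _ _ induced
         (b , _ , ζ , (ζ-fixed , ζ-moved) , unique , c , sᶜζ-fixed , t-moves-s⁻ᶜtζ) reflexible
  with y , y-inverts-s , y-centralises-t ← reflexible⇒conjugator t² induced reflexible =
  t-moves-s⁻ᶜtζ (subst (λ ξ → Fixes t (s ^ (- c) ⟨$⟩ʳ ξ)) yζ≡tζ
                       (subst (Fixes t) (intertwines (Conjugates-inverting-^ y-inverts-s c) ζ)
                              (Conjugates-Fixes y-centralises-t sᶜζ-fixed)))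
  where
  yζ≡tζ : y ⟨$⟩ʳ ζ ≡ t ⟨$⟩ʳ ζ
  yζ≡tζ = conjugator-moves-unique-point-by-t t² y-inverts-s y-centralises-t b ζ-fixed ζ-moved unique
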